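{- There are infinitely many graphs $G$ with $\omega(G)<5$, $\zeta(G)=4$ and $\chi(G)=7$.
   Context: All graphs are finite and simple. $\chi(G)$ is the chromatic number and $\omega(G)$ the clique number. A vertex set is homogeneous if it is independent or a clique; the cochromatic number $\zeta(G)$ is the minimum number of parts in a partition of $V(G)$ into homogeneous sets. -}

module Defs where

open import Data.Nat using (ℕ; _≤_)
open import Data.Fin using (Fin)
open import Data.Bool using (Bool; true; false)
open import Data.Product using (Σ; _×_)
open import Data.Sum using (_⊎_)
open import Relation.Binary.PropositionalEquality using (_≡_; _≢_)
open import Relation.Nullary using (¬_)
open import Function.Definitions using (Injective)

record Graph : Set where
  field
    order : ℕ
    adj   : Fin order → Fin order → Bool
    sym   : ∀ u v → adj u v ≡ adj v u
    irrefl : ∀ v → adj v v ≡ false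

open Graph public

Adj : (G : Graph) → Fin (order G) → Fin (order G) → Set
Adj G u v = adj G u v ≡ true

HasClique : (G : Graph) → ℕ → Set
HasClique G k = Σ (Fin k → Fin (order G)) λ f →
  Injective _≡_ _≡_ f × (∀ i j → i ≢ j → Adj G (f i) (f j))

IsCliqueNumber : Graph → ℕ → Set
IsCliqueNumber G k = HasClique G k × (∀ j → HasClique G j → j ≤ k)

Colorable : Graph → ℕ → Set
Colorable G k = Σ (Fin (order G) → Fin k) λ c →
  ∀ u v → Adj G u v → c u ≢ c v

IsChromaticNumber : Graph → ℕ → Set
IsChromaticNumber G k = Colorable G k × (∀ j → Colorable G j → k ≤ j)

Independent : (G : Graph) → (Fin (order G) → Set) → Set
Independent G S = ∀ u v → S u → S v → ¬ Adj G u v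

IsClique : (G : Graph) → (Fin (order G) → Set) → Set
IsClique G S = ∀ u v → S u → S v → u ≢ v → Adj G u v

Homogeneous : (G : Graph) → (Fin (order G) → Set) → Set
Homogeneous G S = Independent G S ⊎ IsClique G S

-- partition of V(G) into (at most) k homogeneous sets, given as a labelling;
-- the parts are the fibres of p
Cocolorable : Graph → ℕ → Set
Cocolorable G k = Σ (Fin (order G) → Fin k) λ p →
  ∀ i → Homogeneous G (λ v → p v ≡ i)

IsCochromaticNumber : Graph → ℕ → Set
IsCochromaticNumber G k = Cocolorable G k × (∀ j → Cocolorable G j → k ≤ j)

-- The complement H of the circulant graph C₁₃(1,5) has no independent set of size 3 and no
-- clique of size 5, but contains a 4-clique.  By the pigeonhole principle a colouring of its
-- 13 vertices needs at least 7 colour classes of size ≤ 2, and a partition into 3 homogeneous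
-- sets would have a part of size ≥ 5; explicit partitions show χ(H) = 7 and ζ(H) = 4.  Adding
-- any number of isolated vertices preserves ω, χ and ζ (the new vertices join an independent
-- part), which gives infinitely many such graphs.
module Submission where

open import Defs hiding (sym)
open import Data.Nat using (ℕ; zero; suc; _+_; _*_; _≤_; _<_; s≤s; ∣_-_∣)
open import Data.Nat.Properties using (∣-∣-comm; ∣n-n∣≡0; ≤-refl; m≤m+n; <-≤-trans; ≮⇒≥; *-cancelʳ-<; +-suc; m≤n+m)
open import Data.Fin using (Fin; zero; suc; toℕ; _↑ˡ_; splitAt; inject≤; #_; _≟_)
open import Data.Fin.Properties using (suc-injective; ↑ˡ-injective; inject≤-injective; splitAt-↑ˡ; splitAt⁻¹-↑ˡ; all?)
open import Data.Vec using (Vec; []; _∷_; lookup; replicate; sum; _[_]≔_)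
open import Data.Vec.Properties using (lookup∘update; lookup∘update′; lookup-replicate)
open import Data.Bool using (Bool; true; false)
import Data.Bool.Properties as Bool
open import Data.Product using (Σ; ∃-syntax; _×_; _,_)
open import Data.Sum using (_⊎_; inj₁; inj₂; [_,_])
import Data.Sum as Sum
open import Data.Empty using (⊥; ⊥-elim)
open import Function using (_∘_; id; const)
open import Function.Definitions using (Injective)
open import Relation.Binary.PropositionalEquality using (_≡_; _≢_; refl; sym; trans; cong; subst)
open import Relation.Nullary using (¬_; Dec; yes; no; ¬?)
open import Relation.Nullary.Decidable using (_→-dec_; _⊎-dec_; True; toWitness)

record FibreEmbedding {n m : ℕ} (f : Fin n → Fin m) (c : Fin m) (k : ℕ) : Set where
  constructor embedding
  field
    point     : Fin k → Fin n
    injective : Injective _≡_ _≡_ point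
    in-fibre  : ∀ i → f (point i) ≡ c

module _ {n m : ℕ} {f : Fin (suc n) → Fin m} {c : Fin m} where

  fibreEmbedding-shift : ∀ {k} → FibreEmbedding (f ∘ suc) c k → FibreEmbedding f c k
  fibreEmbedding-shift (embedding g g-inj g-fib) =
    embedding (suc ∘ g) (g-inj ∘ suc-injective) g-fib

  fibreEmbedding-cons : ∀ {k} → f zero ≡ c → FibreEmbedding (f ∘ suc) c k →
                        FibreEmbedding f c (suc k)
  fibreEmbedding-cons f0≡c (embedding g g-inj g-fib) = embedding h h-inj h-fib
    where
    h : Fin (suc _) → Fin (suc n)
    h zero    = zero
    h (suc i) = suc (g i)
    h-inj : Injective _≡_ _≡_ h
    h-inj {zero}  {zero}  _  = refl
    h-inj {suc i} {suc j} eq = cong suc (g-inj (suc-injective eq))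
    h-inj {zero}  {suc _} ()
    h-inj {suc _} {zero}  ()
    h-fib : ∀ i → f (h i) ≡ c
    h-fib zero    = f0≡c
    h-fib (suc i) = g-fib i

fibreEmbedding-empty : ∀ {n m} {f : Fin n → Fin m} {c} → FibreEmbedding f c 0
fibreEmbedding-empty = embedding (λ ()) (λ { {()} }) λ ()

fibreEmbedding-cast : ∀ {n m} {f : Fin n → Fin m} {c k l} → k ≡ l →
                      FibreEmbedding f c k → FibreEmbedding f c l
fibreEmbedding-cast refl e = e

sum-[]≔ : ∀ {m r} (xs : Vec ℕ m) i → lookup xs i ≡ suc r →
          sum xs ≡ suc (sum (xs [ i ]≔ r))
sum-[]≔ (x ∷ xs) zero    refl = refl
sum-[]≔ (x ∷ xs) (suc i) eq   = trans (cong (x +_) (sum-[]≔ xs i eq)) (+-suc x _)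

sum-replicate : ∀ m k → sum (replicate m k) ≡ m * k
sum-replicate zero    k = refl
sum-replicate (suc m) k = cong (k +_) (sum-replicate m k)

pigeonhole-weighted : ∀ {n m} (cap : Vec ℕ m) (f : Fin n → Fin m) → sum cap < n →
                      ∃[ c ] FibreEmbedding f c (suc (lookup cap c))
pigeonhole-weighted {suc n} cap f (s≤s sum≤n) with lookup cap (f zero) in cap[f0]
... | zero = f zero , fibreEmbedding-cast (cong suc (sym cap[f0]))
                        (fibreEmbedding-cons refl fibreEmbedding-empty)
... | suc r with pigeonhole-weighted (cap [ f zero ]≔ r) (f ∘ suc)
                   (subst (_≤ n) (sum-[]≔ cap (f zero) cap[f0]) sum≤n)
...   | c , e with c ≟ f zero
...     | yes refl = c , fibreEmbedding-cast (cong suc (sym cap[f0]))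
                           (fibreEmbedding-cons refl
                             (fibreEmbedding-cast (cong suc (lookup∘update c cap r)) e))
...     | no c≢f0 = c , fibreEmbedding-cast (cong suc (lookup∘update′ c≢f0 cap r))
                          (fibreEmbedding-shift e)

pigeonhole-multiple : ∀ {n m} k (f : Fin n → Fin m) → m * k < n →
                      ∃[ c ] FibreEmbedding f c (suc k)
pigeonhole-multiple {m = m} k f mk<n
  with c , e ← pigeonhole-weighted (replicate m k) f
                 (subst (_< _) (sym (sum-replicate m k)) mk<n)
  = c , fibreEmbedding-cast (cong suc (lookup-replicate c k)) e

Vertex : Graph → Set
Vertex G = Fin (order G)

HasIndependentSet : (G : Graph) → ℕ → Set
HasIndependentSet G k = Σ (Fin k → Vertex G) λ f →
  Injective _≡_ _≡_ f × (∀ i j → ¬ Adj G (f i) (f j))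

module _ {G : Graph} where

  adj⇒≢ : ∀ {u v} → Adj G u v → u ≢ v
  adj⇒≢ {u} uv refl with () ← trans (sym (irrefl G u)) uv

  hasClique-≤ : ∀ {k l} → k ≤ l → HasClique G l → HasClique G k
  hasClique-≤ k≤l (f , f-inj , f-adj) =
    f ∘ inj , inject≤-injective k≤l k≤l _ _ ∘ f-inj ,
    λ i j i≢j → f-adj (inj i) (inj j) (i≢j ∘ inject≤-injective k≤l k≤l i j)
    where
    inj : Fin _ → Fin _
    inj i = inject≤ i k≤l

  hasIndependentSet-≤ : ∀ {k l} → k ≤ l → HasIndependentSet G l → HasIndependentSet G k
  hasIndependentSet-≤ k≤l (f , f-inj , f-indep) =
    f ∘ inj , inject≤-injective k≤l k≤l _ _ ∘ f-inj , λ i j → f-indep (inj i) (inj j)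
    where
    inj : Fin _ → Fin _
    inj i = inject≤ i k≤l

  noClique⇒≤ : ∀ {k} → ¬ HasClique G (suc k) → ∀ j → HasClique G j → j ≤ k
  noClique⇒≤ noClique j clique = ≮⇒≥ λ k<j → noClique (hasClique-≤ k<j clique)

  colorable⇒order≤ : ∀ {s j} → ¬ HasIndependentSet G (suc s) →
                     Colorable G j → order G ≤ j * s
  colorable⇒order≤ {s} noIndependent (c , proper) = ≮⇒≥ λ js<n →
    let _ , embedding g g-inj g-fib = pigeonhole-multiple s c js<n
    in noIndependent
         (g , g-inj , λ x y xy → proper _ _ xy (trans (g-fib x) (sym (g-fib y))))

  cocolorable⇒order≤ : ∀ {s j} → ¬ HasIndependentSet G (suc s) → ¬ HasClique G (suc s) →
                       Cocolorable G j → order G ≤ j * s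
  cocolorable⇒order≤ {s} noIndependent noClique (p , homogeneous) = ≮⇒≥ λ js<n →
    let i , embedding g g-inj g-fib = pigeonhole-multiple s p js<n
    in [ (λ independent → noIndependent
                            (g , g-inj , λ x y → independent _ _ (g-fib x) (g-fib y)))
       , (λ clique → noClique
                       (g , g-inj , λ x y x≢y → clique _ _ (g-fib x) (g-fib y) (x≢y ∘ g-inj)))
       ] (homogeneous i)

record Homomorphism (G H : Graph) : Set where
  constructor homomorphism
  field
    map          : Vertex G → Vertex H
    preserve-adj : ∀ u v → Adj G u v → Adj H (map u) (map v)

record InducedEmbedding (H G : Graph) : Set where
  constructor inducedEmbedding
  field
    map       : Vertex H → Vertex G
    injective : Injective _≡_ _≡_ map
    adj-map   : ∀ a b → adj G (map a) (map b) ≡ adj H a b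

module _ {G H : Graph} where

  inducedEmbedding⇒homomorphism : InducedEmbedding H G → Homomorphism H G
  inducedEmbedding⇒homomorphism (inducedEmbedding φ _ φ-adj) =
    homomorphism φ λ a b ab → trans (φ-adj a b) ab

  hasClique-homomorphism : ∀ {k} → Homomorphism G H → HasClique G k → HasClique H k
  hasClique-homomorphism (homomorphism φ φ-adj) (f , f-inj , f-adj) =
    φ ∘ f , φf-inj , λ i j i≢j → φ-adj _ _ (f-adj i j i≢j)
    where
    φf-inj : Injective _≡_ _≡_ (φ ∘ f)
    φf-inj {i} {j} eq with i ≟ j
    ... | yes i≡j = i≡j
    ... | no  i≢j = ⊥-elim (adj⇒≢ {H} (φ-adj _ _ (f-adj i j i≢j)) eq)

  colorable-homomorphism : ∀ {k} → Homomorphism G H → Colorable H k → Colorable G k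
  colorable-homomorphism (homomorphism φ φ-adj) (c , proper) =
    c ∘ φ , λ u v uv → proper _ _ (φ-adj u v uv)

  cocolorable-inducedEmbedding : ∀ {k} → InducedEmbedding H G →
                                 Cocolorable G k → Cocolorable H k
  cocolorable-inducedEmbedding (inducedEmbedding φ φ-inj φ-adj) (p , homogeneous) =
    p ∘ φ , λ i → Sum.map independent clique (homogeneous i)
    where
    independent : ∀ {i} → Independent G (λ v → p v ≡ i) →
                  Independent H (λ a → p (φ a) ≡ i)
    independent indep a b pa pb ab = indep _ _ pa pb (trans (φ-adj a b) ab)
    clique : ∀ {i} → IsClique G (λ v → p v ≡ i) → IsClique H (λ a → p (φ a) ≡ i)
    clique cl a b pa pb a≢b = trans (sym (φ-adj a b)) (cl _ _ pa pb (a≢b ∘ φ-inj))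

module _ (H : Graph) (N : ℕ) where

  private
    adj⊎ : Vertex H ⊎ Fin N → Vertex H ⊎ Fin N → Bool
    adj⊎ (inj₁ a) (inj₁ b) = adj H a b
    adj⊎ _        _        = false

    adj⊎-sym : ∀ x y → adj⊎ x y ≡ adj⊎ y x
    adj⊎-sym (inj₁ a) (inj₁ b) = Graph.sym H a b
    adj⊎-sym (inj₁ _) (inj₂ _) = refl
    adj⊎-sym (inj₂ _) (inj₁ _) = refl
    adj⊎-sym (inj₂ _) (inj₂ _) = refl

    adj⊎-irrefl : ∀ x → adj⊎ x x ≡ false
    adj⊎-irrefl (inj₁ a) = irrefl H a
    adj⊎-irrefl (inj₂ _) = refl

  addIsolated : Graph
  addIsolated = record
    { order  = order H + N
    ; adj    = λ u v → adj⊎ (splitAt (order H) u) (splitAt (order H) v)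
    ; sym    = λ u v → adj⊎-sym (splitAt (order H) u) (splitAt (order H) v)
    ; irrefl = λ v → adj⊎-irrefl (splitAt (order H) v)
    }

  addIsolated-embedding : InducedEmbedding H addIsolated
  addIsolated-embedding = inducedEmbedding (_↑ˡ N) (↑ˡ-injective N _ _) adj-↑ˡ
    where
    adj-↑ˡ : ∀ a b → adj addIsolated (a ↑ˡ N) (b ↑ˡ N) ≡ adj H a b
    adj-↑ˡ a b rewrite splitAt-↑ˡ (order H) a N | splitAt-↑ˡ (order H) b N = refl

  addIsolated-retraction : Vertex H → Homomorphism addIsolated H
  addIsolated-retraction a₀ = homomorphism (retract ∘ splitAt (order H)) retract-adj
    where
    retract : Vertex H ⊎ Fin N → Vertex H
    retract = [ id , const a₀ ]
    retract-adj : ∀ u v → Adj addIsolated u v →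
                  Adj H (retract (splitAt (order H) u)) (retract (splitAt (order H) v))
    retract-adj u v uv with splitAt (order H) u | splitAt (order H) v
    ... | inj₁ a | inj₁ b = uv

  module _ {k} (p : Vertex H → Fin k) (i₀ : Fin k) where

    extendParts : Vertex addIsolated → Fin k
    extendParts = [ p , const i₀ ] ∘ splitAt (order H)

    extendParts-independent : ∀ {i} → Independent H (λ a → p a ≡ i) →
                              Independent addIsolated (λ u → extendParts u ≡ i)
    extendParts-independent indep u v pu pv uv with splitAt (order H) u | splitAt (order H) v
    ... | inj₁ a | inj₁ b = indep a b pu pv uv

    extendParts-clique : ∀ {i} → i ≢ i₀ → IsClique H (λ a → p a ≡ i) →
                         IsClique addIsolated (λ u → extendParts u ≡ i)
    extendParts-clique i≢i₀ clique u v pu pv u≢v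
      with splitAt (order H) u in u≡a | splitAt (order H) v in v≡b
    ... | inj₁ a | inj₁ b = clique a b pu pv λ { refl →
                              u≢v (trans (sym (splitAt⁻¹-↑ˡ u≡a)) (splitAt⁻¹-↑ˡ v≡b)) }
    ... | inj₁ _ | inj₂ _ = ⊥-elim (i≢i₀ (sym pv))
    ... | inj₂ _ | _      = ⊥-elim (i≢i₀ (sym pu))

  cocolorable-addIsolated : ∀ {k} (p : Vertex H → Fin k) →
                            (∀ i → Homogeneous H (λ a → p a ≡ i)) →
                            ∀ i₀ → Independent H (λ a → p a ≡ i₀) → Cocolorable addIsolated k
  cocolorable-addIsolated p homogeneous i₀ indep₀ = extendParts p i₀ , homogeneous′
    where
    homogeneous′ : ∀ i → Homogeneous addIsolated (λ u → extendParts p i₀ u ≡ i)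
    homogeneous′ i with i ≟ i₀
    ... | yes refl = inj₁ (extendParts-independent p i₀ indep₀)
    ... | no  i≢i₀ = Sum.map (extendParts-independent p i₀) (extendParts-clique p i₀ i≢i₀)
                             (homogeneous i)

module _ {H : Graph} {N : ℕ} where

  isCliqueNumber-addIsolated : ∀ {w} → Vertex H → IsCliqueNumber H w →
                               IsCliqueNumber (addIsolated H N) w
  isCliqueNumber-addIsolated a₀ (clique , maximal) =
    hasClique-homomorphism (inducedEmbedding⇒homomorphism (addIsolated-embedding H N)) clique ,
    λ j → maximal j ∘ hasClique-homomorphism (addIsolated-retraction H N a₀)

  isChromaticNumber-addIsolated : ∀ {k} → Vertex H → IsChromaticNumber H k →
                                  IsChromaticNumber (addIsolated H N) k
  isChromaticNumber-addIsolated a₀ (colorable , minimal) =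
    colorable-homomorphism (addIsolated-retraction H N a₀) colorable ,
    λ j → minimal j ∘
            colorable-homomorphism (inducedEmbedding⇒homomorphism (addIsolated-embedding H N))

  isCochromaticNumber-addIsolated : ∀ {k} (p : Vertex H → Fin k) →
                                    (∀ i → Homogeneous H (λ a → p a ≡ i)) →
                                    ∀ i₀ → Independent H (λ a → p a ≡ i₀) →
                                    (∀ j → Cocolorable H j → k ≤ j) →
                                    IsCochromaticNumber (addIsolated H N) k
  isCochromaticNumber-addIsolated p homogeneous i₀ indep₀ minimal =
    cocolorable-addIsolated H N p homogeneous i₀ indep₀ ,
    λ j → minimal j ∘ cocolorable-inducedEmbedding (addIsolated-embedding H N)

decide : ∀ {A : Set} (a? : Dec A) {_ : True a?} → A
decide _ {t} = toWitness t

module _ (G : Graph) where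

  adj? : ∀ u v → Dec (Adj G u v)
  adj? u v = adj G u v Bool.≟ true

  module _ {S : Vertex G → Set} (S? : ∀ v → Dec (S v)) where

    independent? : Dec (Independent G S)
    independent? = all? λ u → all? λ v → S? u →-dec S? v →-dec ¬? (adj? u v)

    isClique? : Dec (IsClique G S)
    isClique? = all? λ u → all? λ v → S? u →-dec S? v →-dec ¬? (u ≟ v) →-dec adj? u v

  proper? : ∀ {k} (c : Vertex G → Fin k) → Dec (∀ u v → Adj G u v → c u ≢ c v)
  proper? c = all? λ u → all? λ v → adj? u v →-dec ¬? (c u ≟ c v)

-- The complement of the circulant graph C₁₃(1,5):
-- a and b are adjacent iff a − b ≢ 0, ±1, ±5 (mod 13).
adjacentAtDistance : ℕ → Bool
adjacentAtDistance 0  = false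
adjacentAtDistance 1  = false
adjacentAtDistance 5  = false
adjacentAtDistance 8  = false
adjacentAtDistance 12 = false
adjacentAtDistance _  = true

coC₁₃ : Graph
coC₁₃ = record
  { order  = 13
  ; adj    = λ a b → adjacentAtDistance ∣ toℕ a - toℕ b ∣
  ; sym    = λ a b → cong adjacentAtDistance (∣-∣-comm (toℕ a) (toℕ b))
  ; irrefl = λ a → cong adjacentAtDistance (∣n-n∣≡0 (toℕ a))
  }

private
  Adj? : ∀ a b → Dec (Adj coC₁₃ a b)
  Adj? = adj? coC₁₃

coC₁₃-independentTriple-collides :
  ∀ a b c → ¬ Adj coC₁₃ a b → ¬ Adj coC₁₃ a c → ¬ Adj coC₁₃ b c → a ≡ b ⊎ a ≡ c ⊎ b ≡ c
coC₁₃-independentTriple-collides = decide (all? λ a → all? λ b → all? λ c →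
  ¬? (Adj? a b) →-dec ¬? (Adj? a c) →-dec ¬? (Adj? b c) →-dec (a ≟ b ⊎-dec a ≟ c ⊎-dec b ≟ c))

coC₁₃-noIndependentTriple : ¬ HasIndependentSet coC₁₃ 3
coC₁₃-noIndependentTriple (f , f-inj , f-indep) =
  distinct (coC₁₃-independentTriple-collides (f (# 0)) (f (# 1)) (f (# 2))
                                              (f-indep _ _) (f-indep _ _) (f-indep _ _))
  where
  distinct : f (# 0) ≡ f (# 1) ⊎ f (# 0) ≡ f (# 2) ⊎ f (# 1) ≡ f (# 2) → ⊥
  distinct (inj₁ eq)        with () ← f-inj eq
  distinct (inj₂ (inj₁ eq)) with () ← f-inj eq
  distinct (inj₂ (inj₂ eq)) with () ← f-inj eq

coC₁₃-fourClique-noCommonNeighbour :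
  ∀ a b → Adj coC₁₃ a b → ∀ c → Adj coC₁₃ a c → Adj coC₁₃ b c →
  ∀ d → Adj coC₁₃ a d → Adj coC₁₃ b d → Adj coC₁₃ c d →
  ∀ e → Adj coC₁₃ a e → Adj coC₁₃ b e → Adj coC₁₃ c e → ¬ Adj coC₁₃ d e
coC₁₃-fourClique-noCommonNeighbour = decide (all? λ a → all? λ b → Adj? a b →-dec all? λ c →
  Adj? a c →-dec Adj? b c →-dec all? λ d →
  Adj? a d →-dec Adj? b d →-dec Adj? c d →-dec all? λ e →
  Adj? a e →-dec Adj? b e →-dec Adj? c e →-dec ¬? (Adj? d e))

coC₁₃-noClique₅ : ¬ HasClique coC₁₃ 5
coC₁₃-noClique₅ (f , _ , f-adj) =
  coC₁₃-fourClique-noCommonNeighbour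
    (f (# 0)) (f (# 1)) (f-adj (# 0) (# 1) λ ())
    (f (# 2)) (f-adj (# 0) (# 2) λ ()) (f-adj (# 1) (# 2) λ ())
    (f (# 3)) (f-adj (# 0) (# 3) λ ()) (f-adj (# 1) (# 3) λ ()) (f-adj (# 2) (# 3) λ ())
    (f (# 4)) (f-adj (# 0) (# 4) λ ()) (f-adj (# 1) (# 4) λ ()) (f-adj (# 2) (# 4) λ ())
    (f-adj (# 3) (# 4) λ ())

coC₁₃-clique₄ : HasClique coC₁₃ 4
coC₁₃-clique₄ = f , (λ {i} {j} → decide (all? λ i → all? λ j → f i ≟ f j →-dec i ≟ j) i j) ,
                decide (all? λ i → all? λ j → ¬? (i ≟ j) →-dec Adj? (f i) (f j))
  where
  f : Fin 4 → Vertex coC₁₃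
  f = lookup (# 0 ∷ # 2 ∷ # 4 ∷ # 6 ∷ [])

coC₁₃-cliqueNumber : IsCliqueNumber coC₁₃ 4
coC₁₃-cliqueNumber = coC₁₃-clique₄ , noClique⇒≤ {coC₁₃} coC₁₃-noClique₅

coC₁₃-chromaticNumber : IsChromaticNumber coC₁₃ 7
coC₁₃-chromaticNumber = (colour , decide (proper? coC₁₃ colour)) , atLeast7
  where
  colour : Vertex coC₁₃ → Fin 7
  colour =
    lookup (# 0 ∷ # 0 ∷ # 1 ∷ # 1 ∷ # 2 ∷ # 2 ∷ # 3 ∷ # 3 ∷ # 4 ∷ # 4 ∷ # 5 ∷ # 5 ∷ # 6 ∷ [])
  atLeast7 : ∀ j → Colorable coC₁₃ j → 7 ≤ j
  -- 6 · 2 < 13 ≤ j · 2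
  atLeast7 j colorable = *-cancelʳ-< 2 6 j
    (<-≤-trans ≤-refl (colorable⇒order≤ {coC₁₃} coC₁₃-noIndependentTriple colorable))

-- Three cliques {0,2,4,6}, {1,3,10,12}, {5,7,9,11} and the singleton {8}.
coC₁₃-parts : Vertex coC₁₃ → Fin 4
coC₁₃-parts =
  lookup (# 0 ∷ # 1 ∷ # 0 ∷ # 1 ∷ # 0 ∷ # 2 ∷ # 0 ∷ # 2 ∷ # 3 ∷ # 2 ∷ # 1 ∷ # 2 ∷ # 1 ∷ [])

coC₁₃-parts-homogeneous : ∀ i → Homogeneous coC₁₃ (λ a → coC₁₃-parts a ≡ i)
coC₁₃-parts-homogeneous = decide (all? λ i →
  independent? coC₁₃ (λ a → coC₁₃-parts a ≟ i) ⊎-dec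
  isClique? coC₁₃ (λ a → coC₁₃-parts a ≟ i))

coC₁₃-parts-independent : Independent coC₁₃ (λ a → coC₁₃-parts a ≡ # 3)
coC₁₃-parts-independent = decide (independent? coC₁₃ (λ a → coC₁₃-parts a ≟ # 3))

coC₁₃-cochromaticLowerBound : ∀ j → Cocolorable coC₁₃ j → 4 ≤ j
-- 3 · 4 < 13 ≤ j · 4
coC₁₃-cochromaticLowerBound j cocolorable = *-cancelʳ-< 4 3 j
  (<-≤-trans ≤-refl (cocolorable⇒order≤ {coC₁₃} noIndependent₅ coC₁₃-noClique₅ cocolorable))
  where
  noIndependent₅ : ¬ HasIndependentSet coC₁₃ 5
  noIndependent₅ = coC₁₃-noIndependentTriple ∘ hasIndependentSet-≤ {coC₁₃} (m≤m+n 3 2)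

theorem1p4 : (N : ℕ) → Σ Graph λ G →
    N ≤ order G × (Σ ℕ λ w → IsCliqueNumber G w × w < 5) ×
    IsCochromaticNumber G 4 × IsChromaticNumber G 7
theorem1p4 N =
  addIsolated coC₁₃ N , m≤n+m N 13 ,
  (4 , isCliqueNumber-addIsolated (# 0) coC₁₃-cliqueNumber , ≤-refl) ,
  isCochromaticNumber-addIsolated coC₁₃-parts coC₁₃-parts-homogeneous
                                  (# 3) coC₁₃-parts-independent coC₁₃-cochromaticLowerBound ,
  isChromaticNumber-addIsolated (# 0) coC₁₃-chromaticNumber
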